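{- Let $n\ge1$, let $a_1,\ldots,a_k$ be positive integers with each $a_i\le n$, $A=\sum_{m=1}^k a_m$, let $j\in[\max(a_1,\ldots,a_k),\min(A,n)]$ and let $t$ be a term of $B_j$. Let $D_{j,t}$ be the set of $k$-tuples $(\sigma_1,\ldots,\sigma_k)$ with $\sigma_i$ a term of $B_{a_i}$ for each $i$, such that the set of cards hit by the tuple is exactly $\{1,\ldots,j\}$ and $\sigma_1\sigma_2\cdots\sigma_k=t$ as permutations. Define $\phi_j:D_{j,t}\to Q_j^{a_1,\ldots,a_k}$ by sending $(\sigma_1,\ldots,\sigma_k)$ to the partition $\{\alpha_1,\ldots,\alpha_j\}$ of $[A]$ where $\alpha_i=\{l\in[A]:\text{card } i \text{ is hit by hitter } l\}$. Then $\phi_j$ is well defined and is a bijection.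
   Context: Permutations of $[n]$ are written in deck notation: a word $u=c_1c_2\cdots c_n$ (a deck of cards, position $1$ on top) denotes the permutation sending card $c_i$ to position $i$. Products are computed left to right: $\sigma\tau$ is the map $i\mapsto\tau(\sigma(i))$ (first $\sigma$, then $\tau$, where $\tau$ moves the card in position $p$ to position $\tau(p)$). For $a\in[n]$, a term of $B_a$ is a permutation whose deck word has $a+1,\ldots,n$ in increasing order, and $B_a\in\mathbb{Q}[S_n]$ is the sum of all terms of $B_a$. Hitting: let $s_c=a_1+\cdots+a_c$, $s_0=0$. For a tuple $(\sigma_1,\ldots,\sigma_k)$ with $\sigma_i$ a term of $B_{a_i}$, let $\tau_0$ be the identity deck $12\cdots n$ and $\tau_i=\sigma_1\cdots\sigma_i$. For $i\in[k]$ and $m\in[a_i]$, the card in position $m$ of the deck $\tau_{i-1}$ (which $\sigma_i$ moves to position $\sigma_i(m)$) is said to be hit by hitter $s_{i-1}+m\in[A]$. A card is hit by the tuple if it is hit by some hitter. $Q_j^{a_1,\ldots,a_k}$: with segments $I_c=\{s_{c-1}+1,\ldots,s_c\}$, it is the set of partitions of $[A]$ into exactly $j$ nonempty blocks such that no block contains two elements of the same segment $I_c$ (equivalently: blocks ordered by minima $\alpha_1,\ldots,\alpha_j$; $1,\ldots,a_1$ go into $\alpha_1,\ldots,\alpha_{a_1}$; for $c\ge2$ the elements of $I_c$ starting new blocks fill the next empty blocks in increasing order and the others go into distinct already nonempty blocks). -}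

module Defs where

open import Level using (0ℓ)
open import Data.Nat using (ℕ; zero; suc; _+_; _≤_; _<_)
open import Data.Fin using (Fin; toℕ; zero; suc)
open import Data.Vec using (Vec; []; _∷_; lookup; sum)
open import Data.Fin.Permutation using (Permutation′; _⟨$⟩ʳ_; _⟨$⟩ˡ_; _∘ₚ_; id)
open import Data.Product using (Σ; _×_; _,_)
open import Relation.Binary.PropositionalEquality using (_≡_)

-- Conventions (0-based): card / position  c ∈ [n]  is  Fin n  with label  toℕ c + 1.
-- A permutation σ : Permutation′ n is the map on positions  p ↦ σ ⟨$⟩ʳ p
-- ("moves the card in position p to position σ(p)"); starting from the identity
-- deck, card c ends up in position σ ⟨$⟩ʳ c, so the deck word is  i ↦ σ ⟨$⟩ˡ i.
-- Product σ τ (first σ, then τ) is  σ ∘ₚ τ , with (σ ∘ₚ τ) ⟨$⟩ʳ i = τ ⟨$⟩ʳ (σ ⟨$⟩ʳ i).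

_≈ₚ_ : {n : ℕ} → Permutation′ n → Permutation′ n → Set
σ ≈ₚ τ = ∀ p → σ ⟨$⟩ʳ p ≡ τ ⟨$⟩ʳ p

-- σ is a term of B_a: cards a+1,…,n (0-based: toℕ c ≥ a) appear in increasing
-- order in the deck word, i.e. their positions are increasing.
IsTermB : {n : ℕ} → ℕ → Permutation′ n → Set
IsTermB {n} a σ = (c d : Fin n) → a ≤ toℕ c → toℕ c < toℕ d →
                  toℕ (σ ⟨$⟩ʳ c) < toℕ (σ ⟨$⟩ʳ d)

prodAll : {n k : ℕ} → Vec (Permutation′ n) k → Permutation′ n
prodAll []       = id
prodAll (σ ∷ σs) = σ ∘ₚ prodAll σs

-- τ_{i-1} = σ_1 ⋯ σ_{i-1}  (for the 0-based index i : Fin k, the product of the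
-- first  toℕ i  permutations).
prefixPerm : {n k : ℕ} → Vec (Permutation′ n) k → Fin k → Permutation′ n
prefixPerm (σ ∷ σs) zero    = id
prefixPerm (σ ∷ σs) (suc i) = σ ∘ₚ prefixPerm σs i

offset : {k : ℕ} → Vec ℕ k → Fin k → ℕ
offset (a ∷ as) zero    = 0
offset (a ∷ as) (suc i) = a + offset as i

-- Card c is hit by hitter l (0-based hitter l ↔ hitter toℕ l + 1 ∈ [A]) in the
-- tuple σs with sizes as: for some step i and some (0-based) position m < a_i,
-- l = s_{i-1} + m and the card in position m of the deck τ_{i-1} is c.
HitBy : {n k A : ℕ} → Vec ℕ k → Vec (Permutation′ n) k → Fin n → Fin A → Set
HitBy {k = k} as σs c l =
  Σ (Fin k) λ i → Σ ℕ λ m →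
    (m < lookup as i) × (toℕ l ≡ offset as i + m) × (toℕ (prefixPerm σs i ⟨$⟩ʳ c) ≡ m)

_⇔_ : Set → Set → Set
P ⇔ Q = (P → Q) × (Q → P)

InD : {n k : ℕ} → (as : Vec ℕ k) → ℕ → Permutation′ n → Vec (Permutation′ n) k → Set
InD {n} {k} as j t σs =
  ((i : Fin k) → IsTermB (lookup as i) (lookup σs i)) ×
  ((c : Fin n) → (Σ (Fin (sum as)) λ l → HitBy as σs c l) ⇔ (toℕ c < j)) ×
  (prodAll σs ≈ₚ t)

Blocks : ℕ → ℕ → Set₁
Blocks A j = Fin j → Fin A → Set

IsPartition : {A j : ℕ} → Blocks A j → Set
IsPartition {A} {j} β =
  ((i : Fin j) → Σ (Fin A) λ l → β i l) ×
  ((i i′ : Fin j) (l : Fin A) → β i l → β i′ l → i ≡ i′) ×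
  ((l : Fin A) → Σ (Fin j) λ i → β i l)

InSeg : {k A : ℕ} → Vec ℕ k → Fin k → Fin A → Set
InSeg as c l = (offset as c ≤ toℕ l) × (toℕ l < offset as c + lookup as c)

InQ : {k : ℕ} → (as : Vec ℕ k) → (j : ℕ) → Blocks (sum as) j → Set
InQ {k} as j β =
  IsPartition β ×
  ((i : Fin j) (l l′ : Fin (sum as)) (c : Fin k) →
     β i l → β i l′ → InSeg as c l → InSeg as c l′ → l ≡ l′)

-- Two block families describe the same (unordered) partition {β_1,…,β_j}:
-- they agree up to a relabelling of the blocks.
SamePartition : {A j : ℕ} → Blocks A j → Blocks A j → Set
SamePartition {A} {j} α β =
  Σ (Permutation′ j) λ π → (i : Fin j) (l : Fin A) → α i l ⇔ β (π ⟨$⟩ʳ i) l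

phi : {n k : ℕ} → (as : Vec ℕ k) → (j : ℕ) → Vec (Permutation′ n) k →
      Blocks (sum as) j
phi {n} as j σs i l = Σ (Fin n) λ c → (toℕ c ≡ toℕ i) × HitBy as σs c l

_≈ₜ_ : {n k : ℕ} → Vec (Permutation′ n) k → Vec (Permutation′ n) k → Set
_≈ₜ_ {k = k} σs σs′ = (i : Fin k) → lookup σs i ≈ₚ lookup σs′ i

-- In any tuple of terms σᵢ ∈ B_{aᵢ}, cards that have not been hit yet keep their relative order,
-- so a smaller card is always hit before a larger one; hence the blocks αᵢ of φ_j are numbered
-- by increasing minimum, and a relabelling of blocks preserving φ_j must be the identity. The
-- partition then tells, for every step, which cards lie in the top aᵢ positions of the deck
-- τ_{i-1}; a term of B_a is determined by where it sends the top a positions, and the product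
-- t fixes the rest, so φ_j is injective.
-- Conversely, given a partition, number its blocks by increasing minimum and let card l be the
-- number of the block of hitter l. The deck at time S orders the cards by their first hitter
-- ≥ S, cards not hit from S on coming last in the order given by t. The quotients of the decks
-- at consecutive segment boundaries are terms of B_{aᵢ}; the deck at time 0 is the identity
-- and the deck at time A is t, so the tuple lies in D_{j,t} and maps to the given partition.

module Submission where

open import Defs
open import Data.Nat using (ℕ; zero; suc; _+_; _∸_; _≤_; _<_; z≤n; s≤s; _<?_; _≤?_; s≤s⁻¹)
open import Data.Nat.Properties hiding (_≟_)
open import Data.Fin as Fin using (Fin; toℕ; fromℕ<; zero; suc; punchOut; inject₁; inject≤)
open import Data.Fin.Properties as FinP using (toℕ-injective; toℕ<n; toℕ-fromℕ<; _≟_)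
open import Data.Fin.Induction using (<-weakInduction; >-weakInduction; <-wellFounded; Acc; acc)
open import Data.Vec using (Vec; []; _∷_; lookup; sum)
open import Data.Fin.Permutation
  using (Permutation′; _⟨$⟩ʳ_; _⟨$⟩ˡ_; _∘ₚ_; id; flip; permutation; inverseˡ; inverseʳ)
open import Data.Product using (Σ; ∃; _×_; _,_; proj₁; proj₂)
open import Data.Sum using (_⊎_; inj₁; inj₂)
open import Data.Unit using (tt)
open import Function using (_∘_)
open import Function.Definitions using (Injective)
open import Level using (Level; 0ℓ)
open import Relation.Binary.Core using (_Preserves_⟶_)
open import Relation.Binary.Definitions using (tri<; tri≈; tri>)
open import Relation.Nullary using (¬_; yes; no; contradiction)
open import Relation.Nullary.Decidable using (_×-dec_)
open import Relation.Unary using (Pred; Decidable)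
open import Relation.Binary.PropositionalEquality

private
  variable
    ℓ : Level
    m : ℕ

injective⇒surjective : {f : Fin m → Fin m} → Injective _≡_ _≡_ f → ∀ y → ∃ λ x → f x ≡ y
injective⇒surjective {suc m} {f} f-inj y with FinP.any? (λ x → f x ≟ y)
... | yes found = found
... | no missed = contradiction (FinP.injective⇒≤ g-inj) 1+n≰n
  where
  y≢f : ∀ x → y ≢ f x
  y≢f x y≡fx = missed (x , sym y≡fx)

  g : Fin (suc m) → Fin m
  g x = punchOut (y≢f x)

  g-inj : Injective _≡_ _≡_ g
  g-inj = f-inj ∘ FinP.punchOut-injective (y≢f _) (y≢f _)

injective⇒permutation : {f : Fin m → Fin m} → Injective _≡_ _≡_ f → Permutation′ m
injective⇒permutation {f = f} f-inj = permutation f (proj₁ ∘ surj) (proj₂ ∘ surj)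
  (λ x → f-inj (proj₂ (surj (f x))))
  where
  surj : ∀ y → ∃ λ x → f x ≡ y
  surj = injective⇒surjective f-inj

strictlyIncreasing⇒id : {f : Fin m → Fin m} → f Preserves Fin._<_ ⟶ Fin._<_ → ∀ x → f x ≡ x
strictlyIncreasing⇒id {suc m} {f} f-inc x = toℕ-injective (≤-antisym (below x) (above x))
  where
  inject₁<suc : ∀ (i : Fin m) → toℕ (inject₁ i) < toℕ (suc i)
  inject₁<suc i = s≤s (≤-reflexive (FinP.toℕ-inject₁ i))

  above : ∀ x → toℕ x ≤ toℕ (f x)
  above = <-weakInduction (λ x → toℕ x ≤ toℕ (f x)) z≤n λ i i≤fi →
    ≤-<-trans (subst (_≤ toℕ (f (inject₁ i))) (FinP.toℕ-inject₁ i) i≤fi) (f-inc (inject₁<suc i))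

  below : ∀ x → toℕ (f x) ≤ toℕ x
  below = >-weakInduction (λ x → toℕ (f x) ≤ toℕ x)
    (subst (toℕ (f (Fin.fromℕ m)) ≤_) (sym (FinP.toℕ-fromℕ m)) (FinP.toℕ≤pred[n] (f (Fin.fromℕ m))))
    λ i fi≤i → subst (toℕ (f (inject₁ i)) ≤_) (sym (FinP.toℕ-inject₁ i))
      (≤-pred (<-≤-trans (f-inc (inject₁<suc i)) fi≤i))

count : {P : Pred (Fin m) ℓ} → Decidable P → ℕ
count {zero}  P? = 0
count {suc m} P? with P? zero
... | yes _ = suc (count (P? ∘ suc))
... | no  _ = count (P? ∘ suc)

count-mono : {P Q : Pred (Fin m) ℓ} (P? : Decidable P) (Q? : Decidable Q) →
             (∀ x → P x → Q x) → count P? ≤ count Q?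
count-mono {zero}  P? Q? P⊆Q = z≤n
count-mono {suc m} P? Q? P⊆Q with P? zero | Q? zero | count-mono (P? ∘ suc) (Q? ∘ suc) (P⊆Q ∘ suc)
... | yes _ | yes _ | ih = s≤s ih
... | yes p | no ¬q | ih = contradiction (P⊆Q zero p) ¬q
... | no _  | yes _ | ih = m≤n⇒m≤1+n ih
... | no _  | no _  | ih = ih

count-strict : {P Q : Pred (Fin m) ℓ} (P? : Decidable P) (Q? : Decidable Q) →
               (∀ x → P x → Q x) → ∀ x → Q x → ¬ P x → count P? < count Q?
count-strict P? Q? P⊆Q zero q ¬p with P? zero | Q? zero
... | yes p | _     = contradiction p ¬p
... | no _  | yes _ = s≤s (count-mono (P? ∘ suc) (Q? ∘ suc) (P⊆Q ∘ suc))
... | no _  | no ¬q = contradiction q ¬q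
count-strict P? Q? P⊆Q (suc x) q ¬p
  with P? zero | Q? zero | count-strict (P? ∘ suc) (Q? ∘ suc) (P⊆Q ∘ suc) x q ¬p
... | yes _ | yes _ | ih = s≤s ih
... | yes p | no ¬q | ih = contradiction (P⊆Q zero p) ¬q
... | no _  | yes _ | ih = m<n⇒m<1+n ih
... | no _  | no _  | ih = ih

count-≤-injection : ∀ {a} {P : Pred (Fin m) ℓ} (P? : Decidable P) (h : ∀ x → P x → Fin a) →
                    (∀ x y p q → h x p ≡ h y q → x ≡ y) → count P? ≤ a
count-≤-injection {zero}  P? h h-inj = z≤n
count-≤-injection {suc m} P? h h-inj with P? zero
... | no _ = count-≤-injection (P? ∘ suc) (h ∘ suc) λ x y p q → FinP.suc-injective ∘ h-inj _ _ p q
count-≤-injection {suc m} {a = zero}  P? h h-inj | yes p₀ with () ← h zero p₀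
count-≤-injection {suc m} {a = suc a} P? h h-inj | yes p₀ = s≤s (count-≤-injection (P? ∘ suc) h′ h′-inj)
  where
  h₀≢ : ∀ x q → h zero p₀ ≢ h (suc x) q
  h₀≢ x q e with () ← h-inj zero (suc x) p₀ q e

  h′ : ∀ x → _ → Fin a
  h′ x q = punchOut (h₀≢ x q)

  h′-inj : ∀ x y p q → h′ x p ≡ h′ y q → x ≡ y
  h′-inj x y p q = FinP.suc-injective ∘ h-inj _ _ p q ∘ FinP.punchOut-injective (h₀≢ x p) (h₀≢ y q)

module Rank {n : ℕ} (key : Fin n → ℕ) (key-inj : Injective _≡_ _≡_ key) where

  rank : Fin n → ℕ
  rank c = count (λ c′ → key c′ <? key c)

  rank<n : ∀ c → rank c < n
  rank<n c = <-≤-trans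
    (count-strict (λ c′ → key c′ <? key c) (λ _ → yes tt) _ c tt (<-irrefl refl))
    (count-≤-injection (λ _ → yes tt) (λ x _ → x) λ _ _ _ _ x≡y → x≡y)

  rank-mono : ∀ {c c′} → key c < key c′ → rank c < rank c′
  rank-mono {c} {c′} k<k′ = count-strict (λ x → key x <? key c) (λ x → key x <? key c′)
    (λ _ k<k → <-trans k<k k<k′) c k<k′ (<-irrefl refl)

  rank-cancel-< : ∀ {c c′} → rank c < rank c′ → key c < key c′
  rank-cancel-< {c} {c′} r<r′ with <-cmp (key c) (key c′)
  ... | tri< k<k′ _ _ = k<k′
  ... | tri≈ _ k≡k′ _ = contradiction (cong rank (key-inj k≡k′)) (<⇒≢ r<r′)
  ... | tri> _ _ k>k′ = contradiction (rank-mono k>k′) (<⇒≯ r<r′)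

  rank-bounded : ∀ {S d} c → (∀ c′ → S ≤ key c′) → key c ≡ S + d → rank c ≤ d
  rank-bounded {S} {d} c S≤key kc≡S+d = count-≤-injection (λ c′ → key c′ <? key c) h h-inj
    where
    below : ∀ c′ → key c′ < key c → key c′ ∸ S < d
    below c′ k′<k = subst (key c′ ∸ S <_) (trans (cong (_∸ S) kc≡S+d) (m+n∸m≡n S d))
      (∸-monoˡ-< k′<k (S≤key c′))

    h : ∀ c′ → key c′ < key c → Fin d
    h c′ k′<k = fromℕ< (below c′ k′<k)

    h-inj : ∀ x y p q → h x p ≡ h y q → x ≡ y
    h-inj x y p q hx≡hy = key-inj (begin
      key x         ≡⟨ m∸n+n≡m (S≤key x) ⟨
      key x ∸ S + S ≡⟨ cong (_+ S) (FinP.fromℕ<-injective _ _ (below x p) (below y q) hx≡hy) ⟩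
      key y ∸ S + S ≡⟨ m∸n+n≡m (S≤key y) ⟩
      key y         ∎)
      where open ≡-Reasoning

  rankFin : Fin n → Fin n
  rankFin c = fromℕ< (rank<n c)

  rankPerm : Permutation′ n
  rankPerm = injective⇒permutation {f = rankFin} rankFin-inj
    where
    rankFin-inj : Injective _≡_ _≡_ rankFin
    rankFin-inj {c} {c′} e with <-cmp (key c) (key c′)
    ... | tri< k<k′ _ _ = contradiction (FinP.fromℕ<-injective _ _ _ _ e) (<⇒≢ (rank-mono k<k′))
    ... | tri≈ _ k≡k′ _ = key-inj k≡k′
    ... | tri> _ _ k>k′ = contradiction (FinP.fromℕ<-injective _ _ _ _ e) (>⇒≢ (rank-mono k>k′))

  toℕ-rankPerm : ∀ c → toℕ (rankPerm ⟨$⟩ʳ c) ≡ rank c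
  toℕ-rankPerm c = toℕ-fromℕ< (rank<n c)


Minimal : Pred (Fin m) ℓ → Pred (Fin m) ℓ
Minimal P l = P l × (∀ l′ → toℕ l′ < toℕ l → ¬ P l′)

minimal-unique : {P : Pred (Fin m) ℓ} {l l′ : Fin m} → Minimal P l → Minimal P l′ → l ≡ l′
minimal-unique {l = l} {l′} (p , l-min) (p′ , l′-min) with <-cmp (toℕ l) (toℕ l′)
... | tri< l<l′ _ _ = contradiction p (l′-min l l<l′)
... | tri≈ _ l≡l′ _ = toℕ-injective l≡l′
... | tri> _ _ l>l′ = contradiction p′ (l-min l′ l>l′)

least : {P : Pred (Fin m) ℓ} → Decidable P → ∃ (Minimal P) ⊎ (∀ l → ¬ P l)
least {zero} P? = inj₂ λ ()
least {suc m} P? with P? zero | least (P? ∘ suc)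
... | yes p₀ | _                       = inj₁ (zero , p₀ , λ _ ())
... | no ¬p₀ | inj₁ (l , p , l-min)    =
  inj₁ (suc l , p , λ { zero _ → ¬p₀ ; (suc l′) l′<l → l-min l′ (s≤s⁻¹ l′<l) })
... | no ¬p₀ | inj₂ none               = inj₂ λ { zero → ¬p₀ ; (suc l) → none l }

offset+size≤sum : ∀ {k} (as : Vec ℕ k) i → offset as i + lookup as i ≤ sum as
offset+size≤sum (a ∷ as) zero    = m≤m+n a (sum as)
offset+size≤sum (a ∷ as) (suc i) = subst (_≤ a + sum as) (sym (+-assoc a _ _)) (+-monoʳ-≤ a (offset+size≤sum as i))

segment-decompose : ∀ {k} (as : Vec ℕ k) {l} → l < sum as →
                    Σ (Fin k) λ i → Σ ℕ λ m → m < lookup as i × l ≡ offset as i + m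
segment-decompose (a ∷ as) {l} l<sum with l <? a
... | yes l<a = zero , l , l<a , refl
... | no l≮a =
  let a≤l = ≮⇒≥ l≮a
      (i , m , m<aᵢ , l∸a≡) = segment-decompose as {l ∸ a}
        (+-cancelˡ-< a _ _ (subst (_< a + sum as) (sym (m+[n∸m]≡n a≤l)) l<sum))
  in suc i , m , m<aᵢ , trans (sym (m+[n∸m]≡n a≤l)) (trans (cong (a +_) l∸a≡) (sym (+-assoc a _ m)))

segment-index-unique : ∀ {k} (as : Vec ℕ k) {i i′ : Fin k} {m m′} → m < lookup as i → m′ < lookup as i′ →
                       offset as i + m ≡ offset as i′ + m′ → i ≡ i′
segment-index-unique (a ∷ as) {zero}  {zero}   _   _    _ = refl
segment-index-unique (a ∷ as) {zero}  {suc i′} m<a _    e =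
  contradiction e (<⇒≢ (<-≤-trans m<a (subst (a ≤_) (sym (+-assoc a _ _)) (m≤m+n a _))))
segment-index-unique (a ∷ as) {suc i} {zero}   _   m′<a e =
  contradiction (sym e) (<⇒≢ (<-≤-trans m′<a (subst (a ≤_) (sym (+-assoc a _ _)) (m≤m+n a _))))
segment-index-unique (a ∷ as) {suc i} {suc i′} m<aᵢ m′<aᵢ′ e = cong suc
  (segment-index-unique as m<aᵢ m′<aᵢ′ (+-cancelˡ-≡ a _ _ (trans (sym (+-assoc a _ _)) (trans e (+-assoc a _ _)))))

segment-injective : ∀ {k} (as : Vec ℕ k) {i i′ : Fin k} {m m′} → m < lookup as i → m′ < lookup as i′ →
                    offset as i + m ≡ offset as i′ + m′ → i ≡ i′ × m ≡ m′
segment-injective as {i} {m = m} {m′} m<aᵢ m′<aᵢ′ e with refl ← segment-index-unique as m<aᵢ m′<aᵢ′ e =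
  refl , +-cancelˡ-≡ (offset as i) m m′ e

⟨$⟩ʳ-injective : ∀ {n} (π : Permutation′ n) → Injective _≡_ _≡_ (π ⟨$⟩ʳ_)
⟨$⟩ʳ-injective π {x} {y} πx≡πy = trans (sym (inverseˡ π)) (trans (cong (π ⟨$⟩ˡ_) πx≡πy) (inverseˡ π))

⟨$⟩ˡ-injective : ∀ {n} (π : Permutation′ n) → Injective _≡_ _≡_ (π ⟨$⟩ˡ_)
⟨$⟩ˡ-injective π = ⟨$⟩ʳ-injective (flip π)

-- HitBy as σs c l is Hit as σs c (toℕ l): hitters are natural numbers here so that they can be
-- shifted past a first step (hit-cons).
Hit : ∀ {n k} → Vec ℕ k → Vec (Permutation′ n) k → Fin n → ℕ → Set
Hit {k = k} as σs c l = Σ (Fin k) λ i → Σ ℕ λ m →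
  (m < lookup as i) × (l ≡ offset as i + m) × (toℕ (prefixPerm σs i ⟨$⟩ʳ c) ≡ m)

AreTerms : ∀ {n k} → Vec ℕ k → Vec (Permutation′ n) k → Set
AreTerms as σs = ∀ i → IsTermB (lookup as i) (lookup σs i)

hit-cons : ∀ {n k a} {as : Vec ℕ k} {σ} {σs : Vec (Permutation′ n) k} {c l} →
           Hit as σs (σ ⟨$⟩ʳ c) l → Hit (a ∷ as) (σ ∷ σs) c (a + l)
hit-cons {a = a} (i , m , m<aᵢ , refl , p) = suc i , m , m<aᵢ , sym (+-assoc a _ m) , p

earlier-hit : ∀ {n k} {as : Vec ℕ k} {σs : Vec (Permutation′ n) k} {c c′ l′} → AreTerms as σs →
              toℕ c < toℕ c′ → Hit as σs c′ l′ → ∃ λ l → l < l′ × Hit as σs c l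
earlier-hit {as = a ∷ as} {σ ∷ σs} {c} _ c<c′ (zero , m , m<a , refl , refl) =
  toℕ c , c<c′ , zero , toℕ c , <-trans c<c′ m<a , refl , refl
earlier-hit {as = a ∷ as} {σ ∷ σs} {c} terms c<c′ (suc i , m , m<aᵢ , refl , p) with toℕ c <? a
... | yes c<a = toℕ c , <-≤-trans c<a (subst (a ≤_) (sym (+-assoc a _ m)) (m≤m+n a _)) ,
                zero , toℕ c , c<a , refl , refl
... | no c≮a =
  let σc<σc′ = terms zero c _ (≮⇒≥ c≮a) c<c′
      (l , l< , hit) = earlier-hit {as = as} {σs} (terms ∘ suc) σc<σc′ (i , m , m<aᵢ , refl , p)
  in a + l , subst (a + l <_) (sym (+-assoc a _ m)) (+-monoʳ-< a l<) , hit-cons hit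

module Hits {n k : ℕ} (as : Vec ℕ k) (σs : Vec (Permutation′ n) k) where

  hit<sum : ∀ {c l} → Hit as σs c l → l < sum as
  hit<sum (i , m , m<aᵢ , refl , _) = <-≤-trans (+-monoʳ-< (offset as i) m<aᵢ) (offset+size≤sum as i)

  hitBy : ∀ {c l} (h : Hit as σs c l) → HitBy as σs c (fromℕ< (hit<sum h))
  hitBy {c} h = subst (Hit as σs c) (sym (toℕ-fromℕ< (hit<sum h))) h

  hit-position : ∀ {c l i m} → Hit as σs c l → m < lookup as i → l ≡ offset as i + m →
                 toℕ (prefixPerm σs i ⟨$⟩ʳ c) ≡ m
  hit-position (i′ , m′ , m′<aᵢ′ , refl , p) m<aᵢ e
    with refl , refl ← segment-injective as m<aᵢ m′<aᵢ′ (sym e) = p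

  hit-card-unique : ∀ {c c′ l} → Hit as σs c l → Hit as σs c′ l → c ≡ c′
  hit-card-unique h (i , m , m<aᵢ , e , p) =
    ⟨$⟩ʳ-injective (prefixPerm σs i) (toℕ-injective (trans (hit-position h m<aᵢ e) (sym p)))

  hit-exists : (∀ i → lookup as i ≤ n) → ∀ {l} → l < sum as → Σ (Fin n) λ c → Hit as σs c l
  hit-exists aᵢ≤n l<sum =
    let (i , m , m<aᵢ , e) = segment-decompose as l<sum
        m<n = <-≤-trans m<aᵢ (aᵢ≤n i)
    in prefixPerm σs i ⟨$⟩ˡ fromℕ< m<n , i , m , m<aᵢ , e ,
       trans (cong toℕ (inverseʳ (prefixPerm σs i))) (toℕ-fromℕ< m<n)

term-determined : ∀ {n a} {σ σ′ : Permutation′ n} → IsTermB a σ → IsTermB a σ′ →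
                  (∀ p → toℕ p < a → σ ⟨$⟩ʳ p ≡ σ′ ⟨$⟩ʳ p) → σ ≈ₚ σ′
term-determined {n} {a} {σ} {σ′} σ-term σ′-term agree p =
  trans (sym (inverseʳ σ′)) (cong (σ′ ⟨$⟩ʳ_) (strictlyIncreasing⇒id g-inc p))
  where
  g : Fin n → Fin n
  g p = σ′ ⟨$⟩ˡ (σ ⟨$⟩ʳ p)

  g-fixes-top : ∀ p → toℕ p < a → g p ≡ p
  g-fixes-top p p<a = trans (cong (σ′ ⟨$⟩ˡ_) (agree p p<a)) (inverseˡ σ′)

  g-keeps-bottom : ∀ p → a ≤ toℕ p → a ≤ toℕ (g p)
  g-keeps-bottom p a≤p with toℕ (g p) <? a
  ... | no gp≮a = ≮⇒≥ gp≮a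
  ... | yes gp<a = contradiction (<-≤-trans gp<a a≤p) (<-irrefl (cong toℕ gp≡p))
    where
    gp≡p : g p ≡ p
    gp≡p = ⟨$⟩ʳ-injective σ (trans (agree (g p) gp<a) (inverseʳ σ′))

  g-inc : g Preserves Fin._<_ ⟶ Fin._<_
  g-inc {p} {q} p<q with toℕ q <? a | toℕ p <? a
  ... | yes q<a | _ = subst₂ Fin._<_ (sym (g-fixes-top p (<-trans p<q q<a))) (sym (g-fixes-top q q<a)) p<q
  ... | no q≮a | yes p<a = subst (Fin._< g q) (sym (g-fixes-top p p<a)) (<-≤-trans p<a (g-keeps-bottom q (≮⇒≥ q≮a)))
  ... | no q≮a | no p≮a with <-cmp (toℕ (g p)) (toℕ (g q))
  ...   | tri< gp<gq _ _ = gp<gq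
  ...   | tri≈ _ gp≡gq _ =
    contradiction (cong toℕ (⟨$⟩ʳ-injective σ (⟨$⟩ˡ-injective σ′ (toℕ-injective gp≡gq)))) (<⇒≢ p<q)
  ...   | tri> _ _ gp>gq = contradiction (σ-term p q (≮⇒≥ p≮a) p<q)
    (<⇒≯ (subst₂ Fin._<_ (inverseʳ σ′) (inverseʳ σ′) (σ′-term (g q) (g p) (g-keeps-bottom q (≮⇒≥ q≮a)) gp>gq)))

-- δ and δ′ are the decks the two tuples act on; generalising over them lets the induction peel off
-- the first step.
tuple-determined : ∀ {n k} {as : Vec ℕ k} {σs σs′ : Vec (Permutation′ n) k} {δ δ′ : Permutation′ n} →
  AreTerms as σs → AreTerms as σs′ →
  (∀ i p → toℕ p < lookup as i → (δ ∘ₚ prefixPerm σs i) ⟨$⟩ˡ p ≡ (δ′ ∘ₚ prefixPerm σs′ i) ⟨$⟩ˡ p) →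
  (δ ∘ₚ prodAll σs) ≈ₚ (δ′ ∘ₚ prodAll σs′) → δ ≈ₚ δ′ × σs ≈ₜ σs′
tuple-determined {σs = []} {[]} _ _ _ same-end = same-end , λ ()
tuple-determined {as = a ∷ as} {σ ∷ σs} {σ′ ∷ σs′} {δ} {δ′} terms terms′ same-tops same-end =
  δ≈δ′ , λ { zero → σ≈σ′ ; (suc i) → σs≈σs′ i }
  where
  rest : (δ ∘ₚ σ) ≈ₚ (δ′ ∘ₚ σ′) × σs ≈ₜ σs′
  rest = tuple-determined {as = as} {σs} {σs′} {δ ∘ₚ σ} {δ′ ∘ₚ σ′}
    (terms ∘ suc) (terms′ ∘ suc) (same-tops ∘ suc) same-end

  δσ≈δ′σ′ : (δ ∘ₚ σ) ≈ₚ (δ′ ∘ₚ σ′)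
  δσ≈δ′σ′ = proj₁ rest

  σs≈σs′ : σs ≈ₜ σs′
  σs≈σs′ = proj₂ rest

  σ≈σ′ : σ ≈ₚ σ′
  σ≈σ′ = term-determined {a = a} {σ} {σ′} (terms zero) (terms′ zero) λ p p<a → begin
    σ ⟨$⟩ʳ p                         ≡⟨ cong (σ ⟨$⟩ʳ_) (inverseʳ δ) ⟨
    σ ⟨$⟩ʳ (δ ⟨$⟩ʳ (δ ⟨$⟩ˡ p))         ≡⟨ δσ≈δ′σ′ (δ ⟨$⟩ˡ p) ⟩
    σ′ ⟨$⟩ʳ (δ′ ⟨$⟩ʳ (δ ⟨$⟩ˡ p))       ≡⟨ cong (λ x → σ′ ⟨$⟩ʳ (δ′ ⟨$⟩ʳ x)) (same-tops zero p p<a) ⟩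
    σ′ ⟨$⟩ʳ (δ′ ⟨$⟩ʳ (δ′ ⟨$⟩ˡ p))      ≡⟨ cong (σ′ ⟨$⟩ʳ_) (inverseʳ δ′) ⟩
    σ′ ⟨$⟩ʳ p                        ∎
    where open ≡-Reasoning

  δ≈δ′ : δ ≈ₚ δ′
  δ≈δ′ x = ⟨$⟩ʳ-injective σ (trans (δσ≈δ′σ′ x) (sym (σ≈σ′ (δ′ ⟨$⟩ʳ x))))

module Telescope {n : ℕ} (T : ℕ → Permutation′ n) where

  steps : ∀ {k} → ℕ → Vec ℕ k → Vec (Permutation′ n) k
  steps S []       = []
  steps S (a ∷ as) = (flip (T S) ∘ₚ T (S + a)) ∷ steps (S + a) as

  lookup-steps : ∀ {k} S (as : Vec ℕ k) i →
                 lookup (steps S as) i ≈ₚ (flip (T (S + offset as i)) ∘ₚ T (S + offset as i + lookup as i))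
  lookup-steps S (a ∷ as) zero    p rewrite +-identityʳ S = refl
  lookup-steps S (a ∷ as) (suc i) p rewrite lookup-steps (S + a) as i p | +-assoc S a (offset as i) = refl

  prefix-steps : ∀ {k} S (as : Vec ℕ k) i → prefixPerm (steps S as) i ≈ₚ (flip (T S) ∘ₚ T (S + offset as i))
  prefix-steps S (a ∷ as) zero    c rewrite +-identityʳ S = sym (inverseʳ (T S))
  prefix-steps S (a ∷ as) (suc i) c = begin
    prefixPerm (steps (S + a) as) i ⟨$⟩ʳ (T (S + a) ⟨$⟩ʳ (T S ⟨$⟩ˡ c))
      ≡⟨ prefix-steps (S + a) as i _ ⟩
    T (S + a + offset as i) ⟨$⟩ʳ (T (S + a) ⟨$⟩ˡ (T (S + a) ⟨$⟩ʳ (T S ⟨$⟩ˡ c)))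
      ≡⟨ cong (T _ ⟨$⟩ʳ_) (inverseˡ (T (S + a))) ⟩
    T (S + a + offset as i) ⟨$⟩ʳ (T S ⟨$⟩ˡ c)
      ≡⟨ cong (λ S′ → T S′ ⟨$⟩ʳ (T S ⟨$⟩ˡ c)) (+-assoc S a _) ⟩
    T (S + (a + offset as i)) ⟨$⟩ʳ (T S ⟨$⟩ˡ c)
      ∎
    where open ≡-Reasoning

  prodAll-steps : ∀ {k} S (as : Vec ℕ k) → prodAll (steps S as) ≈ₚ (flip (T S) ∘ₚ T (S + sum as))
  prodAll-steps S []       c rewrite +-identityʳ S = sym (inverseʳ (T S))
  prodAll-steps S (a ∷ as) c = begin
    prodAll (steps (S + a) as) ⟨$⟩ʳ (T (S + a) ⟨$⟩ʳ (T S ⟨$⟩ˡ c))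
      ≡⟨ prodAll-steps (S + a) as _ ⟩
    T (S + a + sum as) ⟨$⟩ʳ (T (S + a) ⟨$⟩ˡ (T (S + a) ⟨$⟩ʳ (T S ⟨$⟩ˡ c)))
      ≡⟨ cong (T _ ⟨$⟩ʳ_) (inverseˡ (T (S + a))) ⟩
    T (S + a + sum as) ⟨$⟩ʳ (T S ⟨$⟩ˡ c)
      ≡⟨ cong (λ S′ → T S′ ⟨$⟩ʳ (T S ⟨$⟩ˡ c)) (+-assoc S a _) ⟩
    T (S + (a + sum as)) ⟨$⟩ʳ (T S ⟨$⟩ˡ c)
      ∎
    where open ≡-Reasoning

inSeg⇒segment : ∀ {k A} (as : Vec ℕ k) i {l : Fin A} → InSeg as i l →
                Σ ℕ λ m → m < lookup as i × toℕ l ≡ offset as i + m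
inSeg⇒segment as i {l} (offset≤l , l<end) =
  toℕ l ∸ offset as i ,
  +-cancelˡ-< (offset as i) _ _ (subst (_< offset as i + lookup as i) (sym (m+[n∸m]≡n offset≤l)) l<end) ,
  sym (m+[n∸m]≡n offset≤l)

module _ {n k : ℕ} (as : Vec ℕ k) (aᵢ≤n : ∀ i → lookup as i ≤ n) {j : ℕ} (j≤n : j ≤ n) where

  phi-wellDefined : ∀ {t : Permutation′ n} {σs} → InD as j t σs → InQ as j (phi as j σs)
  phi-wellDefined {σs = σs} (_ , hit⇔<j , _) = (nonempty , disjoint , covering) , one-per-segment
    where
    open Hits as σs

    nonempty : ∀ i → Σ (Fin (sum as)) (phi as j σs i)
    nonempty i =
      let card = inject≤ i j≤n
          card≡i = FinP.toℕ-inject≤ i j≤n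
          (l , h) = proj₂ (hit⇔<j card) (subst (_< j) (sym card≡i) (toℕ<n i))
      in l , card , card≡i , h

    disjoint : ∀ i i′ l → phi as j σs i l → phi as j σs i′ l → i ≡ i′
    disjoint i i′ l (c , c≡i , h) (c′ , c′≡i′ , h′) =
      toℕ-injective (trans (sym c≡i) (trans (cong toℕ (hit-card-unique h h′)) c′≡i′))

    covering : ∀ l → Σ (Fin j) λ i → phi as j σs i l
    covering l =
      let (c , h) = hit-exists aᵢ≤n (toℕ<n l)
          c<j = proj₁ (hit⇔<j c) (l , h)
      in fromℕ< c<j , c , sym (toℕ-fromℕ< c<j) , h

    one-per-segment : ∀ i l l′ s → phi as j σs i l → phi as j σs i l′ →
                      InSeg as s l → InSeg as s l′ → l ≡ l′
    one-per-segment i l l′ s (c , c≡i , h) (c′ , c′≡i , h′) l∈s l′∈s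
      with refl ← toℕ-injective {i = c} {c′} (trans c≡i (sym c′≡i)) =
      let (m , m<aₛ , l≡) = inSeg⇒segment as s l∈s
          (m′ , m′<aₛ , l′≡) = inSeg⇒segment as s l′∈s
      in toℕ-injective (trans l≡ (trans (cong (offset as s +_)
           (trans (sym (hit-position h m<aₛ l≡)) (hit-position h′ m′<aₛ l′≡))) (sym l′≡)))

  phi-earlier : ∀ {σs : Vec (Permutation′ n) k} → AreTerms as σs → ∀ {x y : Fin j} {l′} →
                toℕ x < toℕ y → phi as j σs y l′ → Σ (Fin (sum as)) λ l → toℕ l < toℕ l′ × phi as j σs x l
  phi-earlier {σs} terms {x} x<y (c′ , c′≡y , h′) =
    let card = inject≤ x j≤n
        card<c′ = subst₂ _<_ (sym (FinP.toℕ-inject≤ x j≤n)) (sym c′≡y) x<y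
        (l , l<l′ , h) = earlier-hit {as = as} {σs} terms card<c′ h′
    in fromℕ< (Hits.hit<sum as σs h) , subst (_< _) (sym (toℕ-fromℕ< _)) l<l′ ,
       card , FinP.toℕ-inject≤ x j≤n , Hits.hitBy as σs h

  module Injectivity {t : Permutation′ n} {σs σs′ : Vec (Permutation′ n) k}
    (D : InD as j t σs) (D′ : InD as j t σs′) (π : Permutation′ j)
    (same-blocks : ∀ i l → phi as j σs i l ⇔ phi as j σs′ (π ⟨$⟩ʳ i) l) where

    terms : AreTerms as σs
    terms = proj₁ D

    terms′ : AreTerms as σs′
    terms′ = proj₁ D′

    hit⇔<j : ∀ c → (Σ (Fin (sum as)) λ l → HitBy as σs c l) ⇔ (toℕ c < j)
    hit⇔<j = proj₁ (proj₂ D)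

    nonempty : ∀ i → Σ (Fin (sum as)) (phi as j σs i)
    nonempty = proj₁ (proj₁ (phi-wellDefined {t} {σs} D))

    -- Infinite descent: an element of block y of σs gives a smaller one of block x, i.e. of block π x
    -- of σs′, hence a still smaller one of block π y of σs′, i.e. of block y of σs.
    block-empty : ∀ {x y} → toℕ x < toℕ y → toℕ (π ⟨$⟩ʳ y) < toℕ (π ⟨$⟩ʳ x) →
                  ∀ l → Acc Fin._<_ l → ¬ phi as j σs y l
    block-empty {x} {y} x<y πy<πx l (acc smaller) l∈y =
      let (l₁ , l₁<l , l₁∈x) = phi-earlier {σs} terms x<y l∈y
          (l₂ , l₂<l₁ , l₂∈πy) = phi-earlier {σs′} terms′ πy<πx (proj₁ (same-blocks x l₁) l₁∈x)
      in block-empty x<y πy<πx l₂ (smaller (<-trans l₂<l₁ l₁<l)) (proj₂ (same-blocks y l₂) l₂∈πy)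

    π-inc : (π ⟨$⟩ʳ_) Preserves Fin._<_ ⟶ Fin._<_
    π-inc {x} {y} x<y with <-cmp (toℕ (π ⟨$⟩ʳ x)) (toℕ (π ⟨$⟩ʳ y))
    ... | tri< πx<πy _ _ = πx<πy
    ... | tri≈ _ πx≡πy _ = contradiction (cong toℕ (⟨$⟩ʳ-injective π (toℕ-injective πx≡πy))) (<⇒≢ x<y)
    ... | tri> _ _ πx>πy =
      let (l , l∈y) = nonempty y in contradiction l∈y (block-empty x<y πx>πy l (<-wellFounded l))

    same-hits : ∀ c l → HitBy as σs c l → HitBy as σs′ c l
    same-hits c l h =
      let c<j = proj₁ (hit⇔<j c) (l , h)
          (c′ , c′≡ , h′) = proj₁ (same-blocks (fromℕ< c<j) l) (c , sym (toℕ-fromℕ< c<j) , h)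
          c′≡c = toℕ-injective (trans c′≡ (trans (cong toℕ (strictlyIncreasing⇒id π-inc _)) (toℕ-fromℕ< c<j)))
      in subst (λ c → HitBy as σs′ c l) c′≡c h′

    same-tops : ∀ i p → toℕ p < lookup as i → prefixPerm σs i ⟨$⟩ˡ p ≡ prefixPerm σs′ i ⟨$⟩ˡ p
    same-tops i p p<aᵢ =
      let τ = prefixPerm σs i
          τ′ = prefixPerm σs′ i
          h : Hit as σs (τ ⟨$⟩ˡ p) (offset as i + toℕ p)
          h = i , toℕ p , p<aᵢ , refl , cong toℕ (inverseʳ τ)
          h′ = same-hits _ _ (Hits.hitBy as σs h)
          τ′c≡p = toℕ-injective (Hits.hit-position as σs′ h′ p<aᵢ (toℕ-fromℕ< (Hits.hit<sum as σs h)))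
      in trans (sym (inverseˡ τ′)) (cong (τ′ ⟨$⟩ˡ_) τ′c≡p)

    injective : σs ≈ₜ σs′
    injective = proj₂ (tuple-determined {as = as} {σs} {σs′} {id} {id} terms terms′ same-tops
      λ x → trans (proj₂ (proj₂ D) x) (sym (proj₂ (proj₂ D′) x)))

  module Surjectivity {t : Permutation′ n} (t-term : IsTermB j t) {β : Blocks (sum as) j} (Q : InQ as j β) where

    A : ℕ
    A = sum as

    block : Fin A → Fin j
    block l = proj₁ (proj₂ (proj₂ (proj₁ Q)) l)

    block-∈ : ∀ l → β (block l) l
    block-∈ l = proj₂ (proj₂ (proj₂ (proj₁ Q)) l)

    block-unique : ∀ {b l} → β b l → block l ≡ b
    block-unique {b} {l} l∈b = proj₁ (proj₂ (proj₁ Q)) (block l) b l (block-∈ l) l∈b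

    first-spec : ∀ b → ∃ (Minimal (λ l → block l ≡ b))
    first-spec b with least (λ l → block l ≟ b)
    ... | inj₁ l-min = l-min
    ... | inj₂ none = let (l , l∈b) = proj₁ (proj₁ Q) b in contradiction (block-unique l∈b) (none l)

    first : Fin j → Fin A
    first b = proj₁ (first-spec b)

    block-first : ∀ b → block (first b) ≡ b
    block-first b = proj₁ (proj₂ (first-spec b))

    first-injective : Injective _≡_ _≡_ (toℕ ∘ first)
    first-injective {b} {b′} e = trans (sym (block-first b)) (trans (cong block (toℕ-injective e)) (block-first b′))

    module Label = Rank (toℕ ∘ first) first-injective

    label : Fin A → Fin j
    label l = Label.rankPerm ⟨$⟩ʳ block l

    card : Fin A → Fin n
    card l = inject≤ (label l) j≤n

    toℕ-card : ∀ l → toℕ (card l) ≡ toℕ (label l)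
    toℕ-card l = FinP.toℕ-inject≤ (label l) j≤n

    card<j : ∀ l → toℕ (card l) < j
    card<j l = subst (_< j) (sym (toℕ-card l)) (toℕ<n (label l))

    card⇒block : ∀ {l l′} → card l ≡ card l′ → block l ≡ block l′
    card⇒block e = ⟨$⟩ʳ-injective Label.rankPerm
      (toℕ-injective (trans (sym (toℕ-card _)) (trans (cong toℕ e) (toℕ-card _))))

    blockOf : ∀ (c : Fin n) → toℕ c < j → Fin j
    blockOf c c<j = Label.rankPerm ⟨$⟩ˡ fromℕ< c<j

    labelRank-blockOf : ∀ (c : Fin n) c<j → Label.rank (blockOf c c<j) ≡ toℕ c
    labelRank-blockOf c c<j =
      trans (sym (Label.toℕ-rankPerm _)) (trans (cong toℕ (inverseʳ Label.rankPerm)) (toℕ-fromℕ< c<j))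

    card-first-blockOf : ∀ (c : Fin n) c<j → card (first (blockOf c c<j)) ≡ c
    card-first-blockOf c c<j = toℕ-injective (begin
      toℕ (card (first b))                  ≡⟨ toℕ-card (first b) ⟩
      toℕ (Label.rankPerm ⟨$⟩ʳ block (first b)) ≡⟨ cong (λ b → toℕ (Label.rankPerm ⟨$⟩ʳ b)) (block-first b) ⟩
      toℕ (Label.rankPerm ⟨$⟩ʳ b)             ≡⟨ cong toℕ (inverseʳ Label.rankPerm) ⟩
      toℕ (fromℕ< c<j)                       ≡⟨ toℕ-fromℕ< c<j ⟩
      toℕ c                                  ∎)
      where
      open ≡-Reasoning
      b : Fin j
      b = blockOf c c<j

    NextHit : ℕ → Fin n → Pred (Fin A) 0ℓ
    NextHit S c l = S ≤ toℕ l × card l ≡ c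

    keyOf : ∀ {S} c → ∃ (Minimal (NextHit S c)) ⊎ (∀ l → ¬ NextHit S c l) → ℕ
    keyOf c (inj₁ (l , _)) = toℕ l
    keyOf c (inj₂ _)       = A + toℕ (t ⟨$⟩ʳ c)

    abstract
      key : ℕ → Fin n → ℕ
      key S c = keyOf c (least (λ l → (S ≤? toℕ l) ×-dec (card l ≟ c)))

      key-cases : ∀ S c → (Σ (Fin A) λ l → Minimal (NextHit S c) l × key S c ≡ toℕ l)
                        ⊎ ((∀ l → ¬ NextHit S c l) × key S c ≡ A + toℕ (t ⟨$⟩ʳ c))
      key-cases S c with least (λ l → (S ≤? toℕ l) ×-dec (card l ≟ c))
      ... | inj₁ (l , l-min) = inj₁ (l , l-min , refl)
      ... | inj₂ none        = inj₂ (none , refl)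

    key-next : ∀ {S c l} → Minimal (NextHit S c) l → key S c ≡ toℕ l
    key-next {S} {c} l-min with key-cases S c
    ... | inj₁ (l′ , l′-min , e) = trans e (cong toℕ (minimal-unique l′-min l-min))
    ... | inj₂ (none , _)        = contradiction (proj₁ l-min) (none _)

    key-none : ∀ {S c} → (∀ l → ¬ NextHit S c l) → key S c ≡ A + toℕ (t ⟨$⟩ʳ c)
    key-none {S} {c} none with key-cases S c
    ... | inj₁ (l , l-min , _) = contradiction (proj₁ l-min) (none l)
    ... | inj₂ (_ , e)         = e

    key-≥ : ∀ {S} c → S ≤ A → S ≤ key S c
    key-≥ {S} c S≤A with key-cases S c
    ... | inj₁ (l , ((S≤l , _) , _) , e) = subst (S ≤_) (sym e) S≤l
    ... | inj₂ (_ , e)                   = subst (S ≤_) (sym e) (≤-trans S≤A (m≤m+n A _))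

    key-injective : ∀ S → Injective _≡_ _≡_ (key S)
    key-injective S {c} {c′} e with key-cases S c | key-cases S c′
    ... | inj₁ (l , ((_ , l↦c) , _) , e₁) | inj₁ (l′ , ((_ , l′↦c′) , _) , e₂) =
      trans (sym l↦c) (trans (cong card (toℕ-injective (trans (sym e₁) (trans e e₂)))) l′↦c′)
    ... | inj₁ (l , _ , e₁) | inj₂ (_ , e₂) =
      contradiction (trans (sym e₁) (trans e e₂)) (<⇒≢ (<-≤-trans (toℕ<n l) (m≤m+n A _)))
    ... | inj₂ (_ , e₁) | inj₁ (l′ , _ , e₂) =
      contradiction (trans (sym e₂) (trans (sym e) e₁)) (<⇒≢ (<-≤-trans (toℕ<n l′) (m≤m+n A _)))
    ... | inj₂ (_ , e₁) | inj₂ (_ , e₂) =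
      ⟨$⟩ʳ-injective t (toℕ-injective (+-cancelˡ-≡ A _ _ (trans (sym e₁) (trans e e₂))))

    key-shift : ∀ {S S′} c → S ≤ S′ → S′ ≤ key S c → key S′ c ≡ key S c
    key-shift {S} {S′} c S≤S′ S′≤key with key-cases S c
    ... | inj₁ (l , ((_ , l↦c) , l-min) , e) =
      trans (key-next ((subst (S′ ≤_) e S′≤key , l↦c) ,
                       λ l′ l′<l (S′≤l′ , l′↦c) → l-min l′ l′<l (≤-trans S≤S′ S′≤l′ , l′↦c))) (sym e)
    ... | inj₂ (none , e) = trans (key-none λ l (S′≤l , l↦c) → none l (≤-trans S≤S′ S′≤l , l↦c)) (sym e)

    module Deck (S : ℕ) = Rank (key S) (key-injective S)

    deck : ℕ → Permutation′ n
    deck S = Deck.rankPerm S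

    offset≤A : ∀ i → offset as i ≤ A
    offset≤A i = ≤-trans (m≤m+n _ _) (offset+size≤sum as i)

    key-segment : ∀ i {l : Fin A} {m} → m < lookup as i → toℕ l ≡ offset as i + m →
                  key (offset as i) (card l) ≡ toℕ l
    key-segment i {l} {m} m<aᵢ l≡ = key-next ((offset≤l , refl) , no-earlier)
      where
      offset≤l : offset as i ≤ toℕ l
      offset≤l = subst (offset as i ≤_) (sym l≡) (m≤m+n _ _)

      l<end : toℕ l < offset as i + lookup as i
      l<end = subst (_< offset as i + lookup as i) (sym l≡) (+-monoʳ-< (offset as i) m<aᵢ)

      no-earlier : ∀ l′ → toℕ l′ < toℕ l → ¬ NextHit (offset as i) (card l) l′
      no-earlier l′ l′<l (offset≤l′ , l′↦c) = <⇒≢ l′<l (cong toℕ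
        (proj₂ Q (block l) l′ l i (subst (λ b → β b l′) (card⇒block l′↦c) (block-∈ l′)) (block-∈ l)
          (offset≤l′ , <-trans l′<l l<end) (offset≤l , l<end)))

    rank-segment : ∀ i {l : Fin A} {m} → m < lookup as i → toℕ l ≡ offset as i + m →
                   Deck.rank (offset as i) (card l) ≡ m
    rank-segment i {l} {m} m<aᵢ l≡ =
      trans (cong (Deck.rank S ∘ card) (sym hitter-m≡l)) (trans (rank-hitter (fromℕ< m<aᵢ)) (toℕ-fromℕ< m<aᵢ))
      where
      S a : ℕ
      S = offset as i
      a = lookup as i

      S+x<A : ∀ (x : Fin a) → S + toℕ x < A
      S+x<A x = <-≤-trans (+-monoʳ-< S (toℕ<n x)) (offset+size≤sum as i)

      hitter : Fin a → Fin A
      hitter x = fromℕ< (S+x<A x)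

      key-hitter : ∀ x → key S (card (hitter x)) ≡ S + toℕ x
      key-hitter x = trans (key-segment i (toℕ<n x) (toℕ-fromℕ< (S+x<A x))) (toℕ-fromℕ< (S+x<A x))

      rank-hitter<a : ∀ x → Deck.rank S (card (hitter x)) < a
      rank-hitter<a x = ≤-<-trans (Deck.rank-bounded S _ (λ c → key-≥ c (offset≤A i)) (key-hitter x)) (toℕ<n x)

      -- On each segment the ranks form a strictly increasing self-map of Fin a, hence the identity.
      g : Fin a → Fin a
      g x = fromℕ< (rank-hitter<a x)

      g-inc : g Preserves Fin._<_ ⟶ Fin._<_
      g-inc {x} {y} x<y = subst₂ _<_ (sym (toℕ-fromℕ< _)) (sym (toℕ-fromℕ< _))
        (Deck.rank-mono S (subst₂ _<_ (sym (key-hitter x)) (sym (key-hitter y)) (+-monoʳ-< S x<y)))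

      rank-hitter : ∀ x → Deck.rank S (card (hitter x)) ≡ toℕ x
      rank-hitter x = trans (sym (toℕ-fromℕ< (rank-hitter<a x))) (cong toℕ (strictlyIncreasing⇒id {f = g} g-inc x))

      hitter-m≡l : hitter (fromℕ< m<aᵢ) ≡ l
      hitter-m≡l = toℕ-injective (trans (toℕ-fromℕ< (S+x<A _)) (trans (cong (S +_) (toℕ-fromℕ< m<aᵢ)) (sym l≡)))

    toℕ-deck : ∀ S c → toℕ (deck S ⟨$⟩ʳ c) ≡ Deck.rank S c
    toℕ-deck S c = Deck.toℕ-rankPerm S c

    key-0-card : ∀ (c : Fin n) c<j → key 0 c ≡ toℕ (first (blockOf c c<j))
    key-0-card c c<j = key-next ((z≤n , card-first-blockOf c c<j) , λ l′ l′<first (_ , l′↦c) →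
      proj₂ (proj₂ (first-spec b)) l′ l′<first
        (trans (card⇒block (trans l′↦c (sym (card-first-blockOf c c<j)))) (block-first b)))
      where
      b : Fin j
      b = blockOf c c<j

    key-0-unhit : ∀ (c : Fin n) → j ≤ toℕ c → key 0 c ≡ A + toℕ (t ⟨$⟩ʳ c)
    key-0-unhit c j≤c = key-none λ l (_ , l↦c) → <⇒≱ (subst (λ c → toℕ c < j) l↦c (card<j l)) j≤c

    key-0-inc : key 0 Preserves Fin._<_ ⟶ _<_
    key-0-inc {c} {c′} c<c′ with toℕ c′ <? j | toℕ c <? j
    ... | yes c′<j | yes c<j = subst₂ _<_ (sym (key-0-card c c<j)) (sym (key-0-card c′ c′<j))
      (Label.rank-cancel-< (subst₂ _<_ (sym (labelRank-blockOf c c<j)) (sym (labelRank-blockOf c′ c′<j)) c<c′))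
    ... | yes c′<j | no c≮j = contradiction (<-trans c<c′ c′<j) c≮j
    ... | no c′≮j | yes c<j = subst₂ _<_ (sym (key-0-card c c<j)) (sym (key-0-unhit c′ (≮⇒≥ c′≮j)))
      (<-≤-trans (toℕ<n _) (m≤m+n A _))
    ... | no c′≮j | no c≮j = subst₂ _<_ (sym (key-0-unhit c (≮⇒≥ c≮j))) (sym (key-0-unhit c′ (≮⇒≥ c′≮j)))
      (+-monoʳ-< A (t-term c c′ (≮⇒≥ c≮j) c<c′))

    deck-0 : ∀ c → deck 0 ⟨$⟩ʳ c ≡ c
    deck-0 = strictlyIncreasing⇒id λ c<c′ →
      subst₂ _<_ (sym (toℕ-deck 0 _)) (sym (toℕ-deck 0 _)) (Deck.rank-mono 0 (key-0-inc c<c′))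

    key-A : ∀ c → key A c ≡ A + toℕ (t ⟨$⟩ʳ c)
    key-A c = key-none λ l (A≤l , _) → <⇒≱ (toℕ<n l) A≤l

    deck-A : deck A ≈ₚ t
    deck-A c = trans (cong (deck A ⟨$⟩ʳ_) (sym (inverseˡ t))) (strictlyIncreasing⇒id {f = g} g-inc (t ⟨$⟩ʳ c))
      where
      g : Fin n → Fin n
      g p = deck A ⟨$⟩ʳ (t ⟨$⟩ˡ p)

      g-inc : g Preserves Fin._<_ ⟶ Fin._<_
      g-inc p<q = subst₂ _<_ (sym (toℕ-deck A _)) (sym (toℕ-deck A _)) (Deck.rank-mono A
        (subst₂ _<_ (sym (key-A _)) (sym (key-A _))
          (+-monoʳ-< A (subst₂ Fin._<_ (sym (inverseʳ t)) (sym (inverseʳ t)) p<q))))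

    deck-step-term : ∀ i → IsTermB (lookup as i) (flip (deck (offset as i)) ∘ₚ deck (offset as i + lookup as i))
    deck-step-term i p q a≤p p<q = subst₂ _<_ (sym (toℕ-deck S′ c)) (sym (toℕ-deck S′ c′))
      (Deck.rank-mono S′ (subst₂ _<_ (sym (key-shift c S≤S′ S′≤kc)) (sym (key-shift c′ S≤S′ (<⇒≤ (≤-<-trans S′≤kc kc<kc′))))
        kc<kc′))
      where
      S a S′ : ℕ
      S = offset as i
      a = lookup as i
      S′ = S + a

      S≤S′ : S ≤ S′
      S≤S′ = m≤m+n S a

      c c′ : Fin n
      c = deck S ⟨$⟩ˡ p
      c′ = deck S ⟨$⟩ˡ q

      rank-deck⁻¹ : ∀ x → Deck.rank S (deck S ⟨$⟩ˡ x) ≡ toℕ x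
      rank-deck⁻¹ x = trans (sym (toℕ-deck S _)) (cong toℕ (inverseʳ (deck S)))

      kc<kc′ : key S c < key S c′
      kc<kc′ = Deck.rank-cancel-< S (subst₂ _<_ (sym (rank-deck⁻¹ p)) (sym (rank-deck⁻¹ q)) p<q)

      -- A card at position ≥ a of deck S has rank ≥ a, so its key is not among the a hitters of segment i.
      S′≤kc : S′ ≤ key S c
      S′≤kc = ≮⇒≥ λ kc<S′ →
        let S≤kc = key-≥ c (offset≤A i)
            kc≡S+d = sym (m+[n∸m]≡n S≤kc)
            d<a = +-cancelˡ-< S _ _ (subst (_< S′) kc≡S+d kc<S′)
            rank≤d = Deck.rank-bounded S c (λ c′ → key-≥ c′ (offset≤A i)) kc≡S+d
        in <⇒≱ d<a (≤-trans (subst (a ≤_) (sym (rank-deck⁻¹ p)) a≤p) rank≤d)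

    open Telescope deck

    σs : Vec (Permutation′ n) k
    σs = steps 0 as

    prefix-σs : ∀ i c → prefixPerm σs i ⟨$⟩ʳ c ≡ deck (offset as i) ⟨$⟩ʳ c
    prefix-σs i c = trans (prefix-steps 0 as i c) (cong (deck (offset as i) ⟨$⟩ʳ_)
      (trans (sym (cong (deck 0 ⟨$⟩ˡ_) (deck-0 c))) (inverseˡ (deck 0))))

    hit⇒card : ∀ {c l} → HitBy as σs c l → card l ≡ c
    hit⇒card {c} (i , m , m<aᵢ , l≡ , pos≡m) = ⟨$⟩ʳ-injective (deck S) (toℕ-injective (begin
      toℕ (deck S ⟨$⟩ʳ card _) ≡⟨ toℕ-deck S _ ⟩
      Deck.rank S (card _)    ≡⟨ rank-segment i m<aᵢ l≡ ⟩
      m                       ≡⟨ pos≡m ⟨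
      toℕ (prefixPerm σs i ⟨$⟩ʳ c) ≡⟨ cong toℕ (prefix-σs i c) ⟩
      toℕ (deck S ⟨$⟩ʳ c)      ∎))
      where
      open ≡-Reasoning
      S : ℕ
      S = offset as i

    card⇒hit : ∀ l → HitBy as σs (card l) l
    card⇒hit l = let (i , m , m<aᵢ , l≡) = segment-decompose as (toℕ<n l) in
      i , m , m<aᵢ , l≡ ,
      trans (cong toℕ (prefix-σs i (card l))) (trans (toℕ-deck _ (card l)) (rank-segment i m<aᵢ l≡))

    σs-∈D : InD as j t σs
    σs-∈D = terms , hits , product
      where
      terms : AreTerms as σs
      terms i p q a≤p p<q = subst₂ (λ x y → toℕ x < toℕ y) (sym (lookup-steps 0 as i p)) (sym (lookup-steps 0 as i q))
        (deck-step-term i p q a≤p p<q)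

      hits : ∀ c → (Σ (Fin A) λ l → HitBy as σs c l) ⇔ (toℕ c < j)
      hits c = (λ (l , h) → subst (λ c → toℕ c < j) (hit⇒card h) (card<j l)) ,
               λ c<j → first (blockOf c c<j) ,
                 subst (λ x → HitBy as σs x (first (blockOf c c<j))) (card-first-blockOf c c<j) (card⇒hit _)

      product : prodAll σs ≈ₚ t
      product c = trans (prodAll-steps 0 as c)
        (trans (cong (deck A ⟨$⟩ʳ_) (trans (sym (cong (deck 0 ⟨$⟩ˡ_) (deck-0 c))) (inverseˡ (deck 0)))) (deck-A c))

    σs-blocks : SamePartition (phi as j σs) β
    σs-blocks = flip Label.rankPerm , λ i l → to i l , from i l
      where
      to : ∀ i l → phi as j σs i l → β (Label.rankPerm ⟨$⟩ˡ i) l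
      to i l (c , c≡i , h) = subst (λ b → β b l) (trans (sym (inverseˡ Label.rankPerm)) (cong (Label.rankPerm ⟨$⟩ˡ_)
        (toℕ-injective (trans (sym (toℕ-card l)) (trans (cong toℕ (hit⇒card h)) c≡i))))) (block-∈ l)

      from : ∀ i l → β (Label.rankPerm ⟨$⟩ˡ i) l → phi as j σs i l
      from i l l∈b = card l , trans (toℕ-card l) (cong toℕ (trans (cong (Label.rankPerm ⟨$⟩ʳ_) (block-unique l∈b))
        (inverseʳ Label.rankPerm))) , card⇒hit l

theorem3p3 : (n k : ℕ) → 1 ≤ n → 1 ≤ k →
    (as : Vec ℕ k) → ((i : Fin k) → 1 ≤ lookup as i) → ((i : Fin k) → lookup as i ≤ n) →
    (j : ℕ) → ((i : Fin k) → lookup as i ≤ j) → j ≤ sum as → j ≤ n →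
    (t : Permutation′ n) → IsTermB j t →
    ((σs : Vec (Permutation′ n) k) → InD as j t σs → InQ as j (phi as j σs)) ×
    ((σs σs′ : Vec (Permutation′ n) k) → InD as j t σs → InD as j t σs′ →
       SamePartition (phi as j σs) (phi as j σs′) → σs ≈ₜ σs′) ×
    ((β : Blocks (sum as) j) → InQ as j β →
       Σ (Vec (Permutation′ n) k) λ σs → InD as j t σs × SamePartition (phi as j σs) β)
-- The lower bounds on n, k, aᵢ and the range of j only make D_{j,t} and Q_j nonempty.
theorem3p3 n k _ _ as _ aᵢ≤n j _ _ j≤n t t-term =
  (λ σs → phi-wellDefined as aᵢ≤n j≤n {t} {σs}) ,
  (λ σs σs′ D D′ (π , same) → Injectivity.injective as aᵢ≤n j≤n {t} {σs} {σs′} D D′ π same) ,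
  λ β Q → let open Surjectivity as aᵢ≤n j≤n {t} t-term {β} Q in σs , σs-∈D , σs-blocks
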